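{- (a) Let $\mathbf{C}$ be a binary constant weight equidistant code of length $n$, weight $w$ and distance $d$, and let $\mathcal{E}(\mathbf{C})$ be the code of length $n+1$ obtained by appending a coordinate equal to $1$ to every codeword. If $\mathbf{C}$ is trivial, then $\mathcal{E}(\mathbf{C})$ is trivial. (b) Let $\mathbb{C}\subseteq\mathcal{G}_q(n,k)$ be an equidistant constant dimension code, identify $\mathbb{F}_q^{n+1}=\{(x,\alpha):x\in\mathbb{F}_q^n,\alpha\in\mathbb{F}_q\}$, for $X\in\mathcal{G}_q(n,k)$ let $(X,0)=\{(x,0):x\in X\}$, let $v\in\mathbb{F}_q^{n+1}\setminus\{(x,0):x\in\mathbb{F}_q^n\}$, and let $\mathcal{E}(\mathbb{C})=\{\langle (X,0)\cup\{v\}\rangle : X\in\mathbb{C}\}\subseteq\mathcal{G}_q(n+1,k+1)$. If $\mathbb{C}$ is trivial, then $\mathcal{E}(\mathbb{C})$ is trivial.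
   Context: A binary code with $m$ codewords of length $n$ is viewed as an $m\times n$ binary matrix whose rows are the codewords; it is called trivial if every column contains at least $m-1$ equal entries. An equidistant constant dimension code $\mathbb{C}\subseteq\mathcal{G}_q(n,k)$ (set of $k$-subspaces of $\mathbb{F}_q^n$ with all pairwise subspace distances $\dim X+\dim Y-2\dim(X\cap Y)$ equal) is called trivial if one of the following holds: (1) each vector $x\in\mathbb{F}_q^n$ is contained either in all codewords of $\mathbb{C}$, in no codeword of $\mathbb{C}$, or in exactly one codeword of $\mathbb{C}$; or (2) the smallest subspace of $\mathbb{F}_q^n$ containing all codewords of $\mathbb{C}$ has dimension $k+1$. $\langle S\rangle$ denotes the linear span of $S$. -}

module Defs where

open import Level using (0ℓ)
open import Data.Nat using (ℕ; zero; suc; _∸_; _≤_) renaming (_+_ to _+ℕ_; _*_ to _*ℕ_)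
open import Data.Bool using (Bool; true; false; _xor_; if_then_else_)
open import Data.Fin using (Fin) renaming (zero to fzero; suc to fsuc)
open import Data.Vec using (Vec; []; _∷_; lookup; zipWith; replicate; map)
open import Data.Product using (Σ; ∃; ∃-syntax; _×_; _,_)
open import Data.Sum using (_⊎_)
open import Relation.Binary.PropositionalEquality using (_≡_; _≢_)
open import Relation.Nullary using (¬_)
open import Algebra.Structures using (IsCommutativeRing)
open import Function.Bundles using (_↔_)

countFin : ∀ {m} → (Fin m → Bool) → ℕ
countFin {zero}  f = 0
countFin {suc m} f = (if f fzero then 1 else 0) +ℕ countFin (λ i → f (fsuc i))


weight : ∀ {n} → Vec Bool n → ℕ
weight []          = 0
weight (true ∷ xs) = suc (weight xs)
weight (false ∷ xs) = weight xs

hamming : ∀ {n} → Vec Bool n → Vec Bool n → ℕ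
hamming x y = weight (zipWith _xor_ x y)

_==ᵇ_ : Bool → Bool → Bool
true  ==ᵇ b = b
false ==ᵇ true = false
false ==ᵇ false = true

-- A binary code with m codewords of length n: an m × n binary matrix
-- whose rows (the codewords) are pairwise distinct.
BinCode : ℕ → ℕ → Set
BinCode m n = Fin m → Vec Bool n

DistinctRows : ∀ {m n} → BinCode m n → Set
DistinctRows {m} C = (i j : Fin m) → i ≢ j → C i ≢ C j

ConstantWeight : ∀ {m n} → BinCode m n → ℕ → Set
ConstantWeight {m} C w = (i : Fin m) → weight (C i) ≡ w

EquidistantBin : ∀ {m n} → BinCode m n → ℕ → Set
EquidistantBin {m} C d = (i j : Fin m) → i ≢ j → hamming (C i) (C j) ≡ d

TrivialBin : ∀ {m n} → BinCode m n → Set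
TrivialBin {m} {n} C =
  (j : Fin n) → ∃[ b ] (m ∸ 1 ≤ countFin (λ i → lookup (C i) j ==ᵇ b))

extendBin : ∀ {m n} → BinCode m n → BinCode m (suc n)
extendBin C i = Data.Vec._∷ʳ_ (C i) true

record Field : Set₁ where
  infixl 6 _+_
  infixl 7 _*_
  field
    Carrier : Set
    _+_ _*_ : Carrier → Carrier → Carrier
    -_      : Carrier → Carrier
    0# 1#   : Carrier
    isCommutativeRing : IsCommutativeRing _≡_ _+_ _*_ -_ 0# 1#
    0≢1     : 0# ≢ 1#
    inverse : ∀ x → x ≢ 0# → ∃[ y ] (x * y ≡ 1#)

HasSize : Field → ℕ → Set
HasSize F q = Fin q ↔ Field.Carrier F

module LinAlg (F : Field) where
  open Field F

  Vecs : ℕ → Set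
  Vecs n = Vec Carrier n

  zeroV : ∀ {n} → Vecs n
  zeroV = replicate _ 0#

  _⊕_ : ∀ {n} → Vecs n → Vecs n → Vecs n
  _⊕_ = zipWith _+_

  _·_ : ∀ {n} → Carrier → Vecs n → Vecs n
  c · x = map (c *_) x

  VSet : ℕ → Set₁
  VSet n = Vecs n → Set

  record IsSubspace {n} (X : VSet n) : Set where
    field
      has0  : X zeroV
      addC  : ∀ {x y} → X x → X y → X (x ⊕ y)
      scalC : ∀ c {x} → X x → X (c · x)

  lincomb : ∀ {n k} → (Fin k → Carrier) → (Fin k → Vecs n) → Vecs n
  lincomb {n} {zero}  c b = zeroV
  lincomb {n} {suc k} c b =
    (c fzero · b fzero) ⊕ lincomb (λ i → c (fsuc i)) (λ i → b (fsuc i))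


  IsBasis : ∀ {n k} → VSet n → (Fin k → Vecs n) → Set
  IsBasis {n} {k} X b =
      ((c : Fin k → Carrier) → lincomb c b ≡ zeroV → (i : Fin k) → c i ≡ 0#)
    × ((v : Vecs n) → X v → ∃[ c ] (v ≡ lincomb c b))
    × ((c : Fin k → Carrier) → X (lincomb c b))

  HasDim : ∀ {n} → VSet n → ℕ → Set
  HasDim {n} X k = IsSubspace X × ∃[ b ] (IsBasis {n} {k} X b)

  InGrass : ∀ {n} → ℕ → VSet n → Set
  InGrass k X = HasDim X k

  _∩_ : ∀ {n} → VSet n → VSet n → VSet n
  (X ∩ Y) v = X v × Y v

  SubDist : ∀ {n} → VSet n → VSet n → ℕ → Set
  SubDist X Y t = ∃[ a ] ∃[ b ] ∃[ c ]
    (HasDim X a × HasDim Y b × HasDim (X ∩ Y) c × t +ℕ 2 *ℕ c ≡ a +ℕ b)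

  data Span {n} (S : VSet n) : VSet n where
    sp-gen  : ∀ {x} → S x → Span S x
    sp-zero : Span S zeroV
    sp-add  : ∀ {x y} → Span S x → Span S y → Span S (x ⊕ y)
    sp-scal : ∀ c {x} → Span S x → Span S (c · x)

  _≐_ : ∀ {n} → VSet n → VSet n → Set
  X ≐ Y = ∀ v → (X v → Y v) × (Y v → X v)

  Code : ℕ → ℕ → Set₁
  Code m n = Fin m → VSet n

  DistinctCode : ∀ {m n} → Code m n → Set
  DistinctCode {m} C = (i j : Fin m) → i ≢ j → ¬ (C i ≐ C j)

  ConstDim : ∀ {m n} → Code m n → ℕ → Set
  ConstDim {m} C k = (i : Fin m) → InGrass k (C i)

  Equidistant : ∀ {m n} → Code m n → Set
  Equidistant {m} C = ∃[ d ] ((i j : Fin m) → i ≢ j → SubDist (C i) (C j) d)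

  ⋃ : ∀ {m n} → Code m n → VSet n
  ⋃ {m} C v = ∃[ i ] C i v

  TrivialCDC : ∀ {m n} → Code m n → ℕ → Set
  TrivialCDC {m} {n} C k =
      ((x : Vecs n) →
            ((i : Fin m) → C i x)
          ⊎ ((i : Fin m) → ¬ C i x)
          ⊎ (∃[ i ] (C i x × ((j : Fin m) → C j x → j ≡ i))))
    ⊎ HasDim (Span (⋃ C)) (suc k)

  -- F^{n+1} identified with pairs (x, α), written as the vector x ∷ʳ α
  pair : ∀ {n} → Vecs n → Carrier → Vecs (suc n)
  pair x α = Data.Vec._∷ʳ_ x α

  lift∪ : ∀ {n} → VSet n → Vecs (suc n) → VSet (suc n)
  lift∪ {n} X v w = (∃[ x ] (X x × w ≡ pair x 0#)) ⊎ (w ≡ v)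

  extendCode : ∀ {m n} → Code m n → Vecs (suc n) → Code m (suc n)
  extendCode C v i = Span (lift∪ (C i) v)

module Submission where

-- (a) Appending the constant coordinate 1 to every codeword adds a column
--     whose m entries are all equal and leaves the old columns untouched,
--     so every column still has at least m - 1 equal entries.
--
-- (b) Let v = (v₀, β) with β ≠ 0.  The map  proj w = init (w - λ(w) v),
--     λ(w) = last w / β,  is the linear projection of F^{n+1} along v onto
--     F^n × {0} ≅ F^n; it satisfies  proj (x,0) = x,  proj v = 0  and
--     w = (proj w, 0) + λ(w) v.  Hence a subspace Y of F^{n+1} containing
--     (X,0) and v, and mapped by proj into X, is exactly proj⁻¹(X)
--     ('over-criterion').  This applies to every extended codeword
--     ⟨(X,0) ∪ {v}⟩ and, when the code is nonempty, to the span of the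
--     extended code over the span of the code.  Incidence triviality pulls
--     back along proj, and a basis b of X extends to the basis v, (b,0) of
--     proj⁻¹(X), so the span dimension k + 1 becomes k + 2.

open import Defs
open import Level using (0ℓ)
open import Data.Nat using (ℕ; zero; suc; _∸_; _≤_) renaming (_+_ to _+ℕ_)
open import Data.Nat.Properties using (m∸n≤m)
open import Data.Bool using (Bool; true; if_then_else_)
open import Data.Fin using (Fin; fromℕ; inject₁) renaming (zero to fzero; suc to fsuc)
open import Data.Fin.Relation.Unary.Top using (View; view; ‵fromℕ; ‵inj₁)
open import Data.Vec using (Vec; []; _∷_; lookup; _∷ʳ_; init; last; initLast)
open import Data.Product using (_×_; ∃-syntax; _,_; proj₁; proj₂)
open import Data.Sum using (_⊎_; inj₁; inj₂)
open import Relation.Binary.PropositionalEquality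
open import Relation.Nullary using (¬_)

countFin-cong : ∀ {m} (f g : Fin m → Bool) → (∀ i → f i ≡ g i) → countFin f ≡ countFin g
countFin-cong {zero}  f g f≗g = refl
countFin-cong {suc m} f g f≗g =
  cong₂ (λ a r → (if a then 1 else 0) +ℕ r) (f≗g fzero)
        (countFin-cong (λ i → f (fsuc i)) (λ i → g (fsuc i)) (λ i → f≗g (fsuc i)))

countFin-true : ∀ m → countFin {m} (λ _ → true) ≡ m
countFin-true zero    = refl
countFin-true (suc m) = cong suc (countFin-true m)

lookup-∷ʳ-last : ∀ {A : Set} {n} (x : Vec A n) a → lookup (x ∷ʳ a) (fromℕ n) ≡ a
lookup-∷ʳ-last []      a = refl
lookup-∷ʳ-last (_ ∷ x) a = lookup-∷ʳ-last x a

lookup-∷ʳ-inject₁ : ∀ {A : Set} {n} (x : Vec A n) a (j : Fin n) →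
  lookup (x ∷ʳ a) (inject₁ j) ≡ lookup x j
lookup-∷ʳ-inject₁ (b ∷ x) a fzero    = refl
lookup-∷ʳ-inject₁ (b ∷ x) a (fsuc j) = lookup-∷ʳ-inject₁ x a j

extendBin-trivial : ∀ {m n} (C : BinCode m n) → TrivialBin C → TrivialBin (extendBin C)
extendBin-trivial {m} {n} C triv j = column (view j)
  where
  column : ∀ {j} → View j → ∃[ b ] (m ∸ 1 ≤ countFin (λ i → lookup (extendBin C i) j ==ᵇ b))
  column ‵fromℕ = true , subst (m ∸ 1 ≤_) all-ones (m∸n≤m m 1)
    where
    all-ones : m ≡ countFin (λ i → lookup (extendBin C i) (fromℕ n) ==ᵇ true)
    all-ones = trans (sym (countFin-true m))
      (countFin-cong _ _ (λ i → sym (cong (_==ᵇ true) (lookup-∷ʳ-last (C i) true))))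
  column (‵inj₁ {i = j} _) with triv j
  ... | b , enough = b , subst (m ∸ 1 ≤_) same-column enough
    where
    same-column : countFin (λ i → lookup (C i) j ==ᵇ b)
                ≡ countFin (λ i → lookup (extendBin C i) (inject₁ j) ==ᵇ b)
    same-column = countFin-cong _ _ (λ i → sym (cong (_==ᵇ b) (lookup-∷ʳ-inject₁ (C i) true j)))

module Extension (F : Field) where
  open Field F
  open LinAlg F
  open import Algebra.Bundles using (CommutativeRing)
  open import Data.Vec.Properties using (zipWith-assoc; zipWith-comm; zipWith-identityʳ;
    init-∷ʳ; last-∷ʳ; map-∷ʳ)

  commutativeRing : CommutativeRing 0ℓ 0ℓ
  commutativeRing = record { isCommutativeRing = isCommutativeRing }

  open CommutativeRing commutativeRing using (+-identityʳ; +-assoc; +-comm; *-assoc; *-comm;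
    *-identityʳ; zeroˡ; zeroʳ; distribˡ; distribʳ; -‿inverseˡ; -‿inverseʳ; ring)
  open import Algebra.Properties.Ring ring using (-0#≈0#; -‿+-comm; -‿distribˡ-*; -‿distribʳ-*; -1*x≈-x)

  ⊕-assoc : ∀ {n} (x y z : Vecs n) → (x ⊕ y) ⊕ z ≡ x ⊕ (y ⊕ z)
  ⊕-assoc = zipWith-assoc +-assoc

  ⊕-comm : ∀ {n} (x y : Vecs n) → x ⊕ y ≡ y ⊕ x
  ⊕-comm = zipWith-comm +-comm

  ⊕-identityʳ : ∀ {n} (x : Vecs n) → x ⊕ zeroV ≡ x
  ⊕-identityʳ = zipWith-identityʳ +-identityʳ

  ⊕-identityˡ : ∀ {n} (x : Vecs n) → zeroV ⊕ x ≡ x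
  ⊕-identityˡ x = trans (⊕-comm zeroV x) (⊕-identityʳ x)

  ⊕-interchange : ∀ {n} (a b c d : Vecs n) → (a ⊕ b) ⊕ (c ⊕ d) ≡ (a ⊕ c) ⊕ (b ⊕ d)
  ⊕-interchange a b c d = begin
    (a ⊕ b) ⊕ (c ⊕ d) ≡⟨ ⊕-assoc a b (c ⊕ d) ⟩
    a ⊕ (b ⊕ (c ⊕ d)) ≡⟨ cong (a ⊕_) (sym (⊕-assoc b c d)) ⟩
    a ⊕ ((b ⊕ c) ⊕ d) ≡⟨ cong (λ t → a ⊕ (t ⊕ d)) (⊕-comm b c) ⟩
    a ⊕ ((c ⊕ b) ⊕ d) ≡⟨ cong (a ⊕_) (⊕-assoc c b d) ⟩
    a ⊕ (c ⊕ (b ⊕ d)) ≡⟨ sym (⊕-assoc a c (b ⊕ d)) ⟩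
    (a ⊕ c) ⊕ (b ⊕ d) ∎
    where open ≡-Reasoning

  ·-distribʳ : ∀ {n} a b (x : Vecs n) → (a + b) · x ≡ (a · x) ⊕ (b · x)
  ·-distribʳ a b []      = refl
  ·-distribʳ a b (c ∷ x) = cong₂ _∷_ (distribʳ c a b) (·-distribʳ a b x)

  ·-distribˡ : ∀ {n} c (x y : Vecs n) → c · (x ⊕ y) ≡ (c · x) ⊕ (c · y)
  ·-distribˡ c []      []      = refl
  ·-distribˡ c (a ∷ x) (b ∷ y) = cong₂ _∷_ (distribˡ c a b) (·-distribˡ c x y)

  ·-assoc : ∀ {n} a b (x : Vecs n) → (a * b) · x ≡ a · (b · x)
  ·-assoc a b []      = refl
  ·-assoc a b (c ∷ x) = cong₂ _∷_ (*-assoc a b c) (·-assoc a b x)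

  ·-zeroˡ : ∀ {n} (x : Vecs n) → 0# · x ≡ zeroV
  ·-zeroˡ []      = refl
  ·-zeroˡ (a ∷ x) = cong₂ _∷_ (zeroˡ a) (·-zeroˡ x)

  ·-zeroʳ : ∀ {n} c → c · zeroV {n} ≡ zeroV
  ·-zeroʳ {zero}  c = refl
  ·-zeroʳ {suc n} c = cong₂ _∷_ (zeroʳ c) (·-zeroʳ c)

  ⊕-·-1 : ∀ {n} (x : Vecs n) → x ⊕ ((- 1#) · x) ≡ zeroV
  ⊕-·-1 []      = refl
  ⊕-·-1 (a ∷ x) = cong₂ _∷_ (trans (cong (a +_) (-1*x≈-x a)) (-‿inverseʳ a)) (⊕-·-1 x)

  split : ∀ {n} (w : Vecs (suc n)) → w ≡ pair (init w) (last w)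
  split w = proj₂ (proj₂ (initLast w))

  pair-⊕ : ∀ {n} (x y : Vecs n) a b → pair x a ⊕ pair y b ≡ pair (x ⊕ y) (a + b)
  pair-⊕ []      []      a b = refl
  pair-⊕ (c ∷ x) (d ∷ y) a b = cong (c + d ∷_) (pair-⊕ x y a b)

  pair-· : ∀ {n} c (x : Vecs n) a → c · pair x a ≡ pair (c · x) (c * a)
  pair-· c x a = map-∷ʳ (c *_) a x

  ⊕-coordinates : ∀ {n} (x y : Vecs (suc n)) → x ⊕ y ≡ pair (init x ⊕ init y) (last x + last y)
  ⊕-coordinates x y =
    trans (cong₂ _⊕_ (split x) (split y)) (pair-⊕ (init x) (init y) (last x) (last y))

  ·-coordinates : ∀ {n} c (x : Vecs (suc n)) → c · x ≡ pair (c · init x) (c * last x)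
  ·-coordinates c x = trans (cong (c ·_) (split x)) (pair-· c (init x) (last x))

  last-⊕ : ∀ {n} (x y : Vecs (suc n)) → last (x ⊕ y) ≡ last x + last y
  last-⊕ x y = trans (cong last (⊕-coordinates x y)) (last-∷ʳ _ (init x ⊕ init y))

  last-· : ∀ {n} c (x : Vecs (suc n)) → last (c · x) ≡ c * last x
  last-· c x = trans (cong last (·-coordinates c x)) (last-∷ʳ _ (c · init x))

  record Linear {a b} (f : Vecs a → Vecs b) : Set where
    field
      map-⊕ : ∀ x y → f (x ⊕ y) ≡ f x ⊕ f y
      map-· : ∀ c x → f (c · x) ≡ c · f x

    map-0 : f zeroV ≡ zeroV
    map-0 = begin
      f zeroV          ≡⟨ cong f (sym (·-zeroˡ zeroV)) ⟩
      f (0# · zeroV)   ≡⟨ map-· 0# zeroV ⟩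
      0# · f zeroV     ≡⟨ ·-zeroˡ (f zeroV) ⟩
      zeroV            ∎
      where open ≡-Reasoning

  open Linear

  ∘-linear : ∀ {a b c} {g : Vecs b → Vecs c} {f : Vecs a → Vecs b} →
    Linear g → Linear f → Linear (λ x → g (f x))
  ∘-linear {g = g} {f} lg lf = record
    { map-⊕ = λ x y → trans (cong g (map-⊕ lf x y)) (map-⊕ lg (f x) (f y))
    ; map-· = λ c x → trans (cong g (map-· lf c x)) (map-· lg c (f x))
    }

  init-linear : ∀ {n} → Linear (init {n = n})
  init-linear = record
    { map-⊕ = λ x y → trans (cong init (⊕-coordinates x y)) (init-∷ʳ (last x + last y) _)
    ; map-· = λ c x → trans (cong init (·-coordinates c x)) (init-∷ʳ (c * last x) _)
    }

  lift0 : ∀ {n} → Vecs n → Vecs (suc n)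
  lift0 x = pair x 0#

  lift0-linear : ∀ {n} → Linear (lift0 {n})
  lift0-linear = record
    { map-⊕ = λ x y → trans (cong (pair (x ⊕ y)) (sym (+-identityʳ 0#))) (sym (pair-⊕ x y 0# 0#))
    ; map-· = λ c x → trans (cong (pair (c · x)) (sym (zeroʳ c))) (sym (pair-· c x 0#))
    }

  lincomb-linear : ∀ {a b k} {f : Vecs a → Vecs b} → Linear f →
    (c : Fin k → Carrier) (u : Fin k → Vecs a) → f (lincomb c u) ≡ lincomb c (λ i → f (u i))
  lincomb-linear {k = zero}      lf c u = map-0 lf
  lincomb-linear {k = suc k} {f} lf c u = begin
    f ((c fzero · u fzero) ⊕ lincomb (λ i → c (fsuc i)) (λ i → u (fsuc i)))
      ≡⟨ map-⊕ lf _ _ ⟩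
    f (c fzero · u fzero) ⊕ f (lincomb (λ i → c (fsuc i)) (λ i → u (fsuc i)))
      ≡⟨ cong₂ _⊕_ (map-· lf (c fzero) (u fzero))
                   (lincomb-linear lf (λ i → c (fsuc i)) (λ i → u (fsuc i))) ⟩
    (c fzero · f (u fzero)) ⊕ lincomb (λ i → c (fsuc i)) (λ i → f (u (fsuc i))) ∎
    where open ≡-Reasoning

  span-subspace : ∀ {n} (S : VSet n) → IsSubspace (Span S)
  span-subspace S = record { has0 = sp-zero ; addC = sp-add ; scalC = sp-scal }

  span-least : ∀ {n} {S Y : VSet n} → IsSubspace Y → (∀ {x} → S x → Y x) →
    ∀ {x} → Span S x → Y x
  span-least subY S⊆Y (sp-gen s)    = S⊆Y s
  span-least subY S⊆Y sp-zero       = IsSubspace.has0 subY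
  span-least subY S⊆Y (sp-add p q)  = IsSubspace.addC subY (span-least subY S⊆Y p) (span-least subY S⊆Y q)
  span-least subY S⊆Y (sp-scal c p) = IsSubspace.scalC subY c (span-least subY S⊆Y p)

  preimage-subspace : ∀ {a b} {f : Vecs a → Vecs b} {Y : VSet b} → Linear f → IsSubspace Y →
    IsSubspace (λ x → Y (f x))
  preimage-subspace {f = f} {Y} lf subY = record
    { has0  = subst Y (sym (map-0 lf)) (IsSubspace.has0 subY)
    ; addC  = λ {x} {y} fx fy → subst Y (sym (map-⊕ lf x y)) (IsSubspace.addC subY fx fy)
    ; scalC = λ c {x} fx → subst Y (sym (map-· lf c x)) (IsSubspace.scalC subY c fx)
    }

  subspace-resp-≐ : ∀ {n} {X Y : VSet n} → X ≐ Y → IsSubspace Y → IsSubspace X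
  subspace-resp-≐ X≐Y subY = record
    { has0  = proj₂ (X≐Y _) (IsSubspace.has0 subY)
    ; addC  = λ x y → proj₂ (X≐Y _) (IsSubspace.addC subY (proj₁ (X≐Y _) x) (proj₁ (X≐Y _) y))
    ; scalC = λ c x → proj₂ (X≐Y _) (IsSubspace.scalC subY c (proj₁ (X≐Y _) x))
    }

  PointTrivial : ∀ {m n} → Code m n → Set
  PointTrivial {m} {n} C = (x : Vecs n) →
      ((i : Fin m) → C i x)
    ⊎ ((i : Fin m) → ¬ C i x)
    ⊎ (∃[ i ] (C i x × ((j : Fin m) → C j x → j ≡ i)))

  pointTrivial-pullback : ∀ {m a b} (f : Vecs a → Vecs b) (D : Code m a) (C : Code m b) →
    (∀ i → D i ≐ (λ w → C i (f w))) → PointTrivial C → PointTrivial D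
  pointTrivial-pullback f D C D≐ trivC w with trivC (f w)
  ... | inj₁ everywhere         = inj₁ (λ i → proj₂ (D≐ i w) (everywhere i))
  ... | inj₂ (inj₁ nowhere)     = inj₂ (inj₁ (λ i Diw → nowhere i (proj₁ (D≐ i w) Diw)))
  ... | inj₂ (inj₂ (i , Cifw , unique)) =
    inj₂ (inj₂ (i , proj₂ (D≐ i w) Cifw , λ j Djw → unique j (proj₁ (D≐ j w) Djw)))

  module Along {n} (v : Vecs (suc n)) (v∉ : ¬ (∃[ x ] (v ≡ pair x 0#))) where

    β : Carrier
    β = last v

    β≢0 : β ≢ 0#
    β≢0 β≡0 = v∉ (init v , trans (split v) (cong (pair (init v)) β≡0))

    β⁻ : Carrier
    β⁻ = proj₁ (inverse β β≢0)

    β*β⁻ : β * β⁻ ≡ 1#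
    β*β⁻ = proj₂ (inverse β β≢0)

    -- The coefficient of v in the decomposition F^{n+1} = (F^n × {0}) ⊕ ⟨v⟩.
    lam : Vecs (suc n) → Carrier
    lam w = last w * β⁻

    lam-⊕ : ∀ x y → lam (x ⊕ y) ≡ lam x + lam y
    lam-⊕ x y = trans (cong (_* β⁻) (last-⊕ x y)) (distribʳ β⁻ (last x) (last y))

    lam-· : ∀ c x → lam (c · x) ≡ c * lam x
    lam-· c x = trans (cong (_* β⁻) (last-· c x)) (*-assoc c (last x) β⁻)

    lam-zero : lam zeroV ≡ 0#
    lam-zero = trans (cong lam (sym (·-zeroˡ zeroV))) (trans (lam-· 0# zeroV) (zeroˡ _))

    lam-lift0 : ∀ x → lam (lift0 x) ≡ 0#
    lam-lift0 x = trans (cong (_* β⁻) (last-∷ʳ 0# x)) (zeroˡ β⁻)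

    lam-scaled : ∀ w → lam w * β ≡ last w
    lam-scaled w = begin
      last w * β⁻ * β   ≡⟨ *-assoc (last w) β⁻ β ⟩
      last w * (β⁻ * β) ≡⟨ cong (last w *_) (trans (*-comm β⁻ β) β*β⁻) ⟩
      last w * 1#       ≡⟨ *-identityʳ (last w) ⟩
      last w            ∎
      where open ≡-Reasoning

    -- w - λ(w) v, the component of w in F^n × {0}.
    flatten : Vecs (suc n) → Vecs (suc n)
    flatten w = w ⊕ ((- lam w) · v)

    flatten-linear : Linear flatten
    flatten-linear = record { map-⊕ = flatten-⊕ ; map-· = flatten-· }
      where
      open ≡-Reasoning
      flatten-⊕ : ∀ x y → flatten (x ⊕ y) ≡ flatten x ⊕ flatten y
      flatten-⊕ x y = begin
        (x ⊕ y) ⊕ ((- lam (x ⊕ y)) · v)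
          ≡⟨ cong (λ t → (x ⊕ y) ⊕ ((- t) · v)) (lam-⊕ x y) ⟩
        (x ⊕ y) ⊕ ((- (lam x + lam y)) · v)
          ≡⟨ cong (λ t → (x ⊕ y) ⊕ (t · v)) (sym (-‿+-comm (lam x) (lam y))) ⟩
        (x ⊕ y) ⊕ ((- lam x + - lam y) · v)
          ≡⟨ cong ((x ⊕ y) ⊕_) (·-distribʳ (- lam x) (- lam y) v) ⟩
        (x ⊕ y) ⊕ (((- lam x) · v) ⊕ ((- lam y) · v))
          ≡⟨ ⊕-interchange x y _ _ ⟩
        flatten x ⊕ flatten y ∎
      flatten-· : ∀ c x → flatten (c · x) ≡ c · flatten x
      flatten-· c x = begin
        (c · x) ⊕ ((- lam (c · x)) · v)
          ≡⟨ cong (λ t → (c · x) ⊕ ((- t) · v)) (lam-· c x) ⟩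
        (c · x) ⊕ ((- (c * lam x)) · v)
          ≡⟨ cong (λ t → (c · x) ⊕ (t · v)) (-‿distribʳ-* c (lam x)) ⟩
        (c · x) ⊕ ((c * - lam x) · v)
          ≡⟨ cong ((c · x) ⊕_) (·-assoc c (- lam x) v) ⟩
        (c · x) ⊕ (c · ((- lam x) · v))
          ≡⟨ sym (·-distribˡ c x _) ⟩
        c · flatten x ∎

    last-flatten : ∀ w → last (flatten w) ≡ 0#
    last-flatten w = begin
      last (w ⊕ ((- lam w) · v))  ≡⟨ last-⊕ w _ ⟩
      last w + last ((- lam w) · v) ≡⟨ cong (last w +_) (last-· (- lam w) v) ⟩
      last w + (- lam w) * β      ≡⟨ cong (last w +_) (sym (-‿distribˡ-* (lam w) β)) ⟩
      last w + - (lam w * β)      ≡⟨ cong (λ t → last w + - t) (lam-scaled w) ⟩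
      last w + - last w           ≡⟨ -‿inverseʳ (last w) ⟩
      0#                          ∎
      where open ≡-Reasoning

    proj : Vecs (suc n) → Vecs n
    proj w = init (flatten w)

    proj-linear : Linear proj
    proj-linear = ∘-linear init-linear flatten-linear

    proj-lift0 : ∀ x → proj (lift0 x) ≡ x
    proj-lift0 x = begin
      init (lift0 x ⊕ ((- lam (lift0 x)) · v)) ≡⟨ cong (λ t → init (lift0 x ⊕ ((- t) · v))) (lam-lift0 x) ⟩
      init (lift0 x ⊕ ((- 0#) · v))            ≡⟨ cong (λ t → init (lift0 x ⊕ (t · v))) -0#≈0# ⟩
      init (lift0 x ⊕ (0# · v))                ≡⟨ cong (λ t → init (lift0 x ⊕ t)) (·-zeroˡ v) ⟩
      init (lift0 x ⊕ zeroV)                   ≡⟨ cong init (⊕-identityʳ (lift0 x)) ⟩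
      init (lift0 x)                           ≡⟨ init-∷ʳ 0# x ⟩
      x                                        ∎
      where open ≡-Reasoning

    proj-v : proj v ≡ zeroV
    proj-v = begin
      init (v ⊕ ((- lam v) · v)) ≡⟨ cong (λ t → init (v ⊕ ((- t) · v))) β*β⁻ ⟩
      init (v ⊕ ((- 1#) · v))    ≡⟨ cong init (⊕-·-1 v) ⟩
      init zeroV                 ≡⟨ map-0 init-linear ⟩
      zeroV                      ∎
      where open ≡-Reasoning

    decompose : ∀ w → w ≡ lift0 (proj w) ⊕ (lam w · v)
    decompose w = sym (begin
      lift0 (proj w) ⊕ (lam w · v)                   ≡⟨ cong (_⊕ (lam w · v)) (sym flattened) ⟩
      (w ⊕ ((- lam w) · v)) ⊕ (lam w · v)            ≡⟨ ⊕-assoc w _ _ ⟩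
      w ⊕ (((- lam w) · v) ⊕ (lam w · v))            ≡⟨ cong (w ⊕_) (sym (·-distribʳ (- lam w) (lam w) v)) ⟩
      w ⊕ ((- lam w + lam w) · v)                    ≡⟨ cong (λ t → w ⊕ (t · v)) (-‿inverseˡ (lam w)) ⟩
      w ⊕ (0# · v)                                   ≡⟨ cong (w ⊕_) (·-zeroˡ v) ⟩
      w ⊕ zeroV                                      ≡⟨ ⊕-identityʳ w ⟩
      w                                              ∎)
      where
      open ≡-Reasoning
      flattened : flatten w ≡ lift0 (proj w)
      flattened = trans (split (flatten w)) (cong (pair (proj w)) (last-flatten w))

    over-criterion : ∀ {X : VSet n} {Y : VSet (suc n)} → IsSubspace Y →
      (∀ {x} → X x → Y (lift0 x)) → Y v → (∀ {w} → Y w → X (proj w)) →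
      Y ≐ (λ w → X (proj w))
    over-criterion {X} {Y} subY lifted Yv projected w = projected , from
      where
      from : X (proj w) → Y w
      from Xpw = subst Y (sym (decompose w))
        (IsSubspace.addC subY (lifted Xpw) (IsSubspace.scalC subY (lam w) Yv))

    extension-spec : ∀ {X : VSet n} → IsSubspace X → Span (lift∪ X v) ≐ (λ w → X (proj w))
    extension-spec {X} subX =
      over-criterion (span-subspace _) (λ Xx → sp-gen (inj₁ (_ , Xx , refl))) (sp-gen (inj₂ refl))
        (span-least (preimage-subspace proj-linear subX) generator)
      where
      generator : ∀ {w} → lift∪ X v w → X (proj w)
      generator (inj₁ (x , Xx , refl)) = subst X (sym (proj-lift0 x)) Xx
      generator (inj₂ refl)            = subst X (sym proj-v) (IsSubspace.has0 subX)

    union-spec : ∀ {m} (C : Code (suc m) n) → (∀ i → IsSubspace (C i)) →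
      Span (⋃ (extendCode C v)) ≐ (λ w → Span (⋃ C) (proj w))
    union-spec C subC =
      over-criterion (span-subspace _) lifted (sp-gen (fzero , sp-gen (inj₂ refl)))
        (span-least (preimage-subspace proj-linear (span-subspace _)) generator)
      where
      lifted : ∀ {x} → Span (⋃ C) x → Span (⋃ (extendCode C v)) (lift0 x)
      lifted = span-least (preimage-subspace lift0-linear (span-subspace _))
        (λ { (i , Cix) → sp-gen (i , sp-gen (inj₁ (_ , Cix , refl))) })
      generator : ∀ {w} → ⋃ (extendCode C v) w → Span (⋃ C) (proj w)
      generator (i , Eiw) = sp-gen (i , proj₁ (extension-spec (subC i) _) Eiw)

    extendedBasis : ∀ {k} → (Fin k → Vecs n) → Fin (suc k) → Vecs (suc n)
    extendedBasis b fzero    = v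
    extendedBasis b (fsuc i) = lift0 (b i)

    extended-lincomb : ∀ {k} (c : Fin (suc k) → Carrier) (b : Fin k → Vecs n) →
      lincomb c (extendedBasis b) ≡ (c fzero · v) ⊕ lift0 (lincomb (λ i → c (fsuc i)) b)
    extended-lincomb c b = cong ((c fzero · v) ⊕_) (sym (lincomb-linear lift0-linear _ b))

    proj-extended : ∀ {k} (c : Fin (suc k) → Carrier) (b : Fin k → Vecs n) →
      proj (lincomb c (extendedBasis b)) ≡ lincomb (λ i → c (fsuc i)) b
    proj-extended c b = begin
      proj (lincomb c (extendedBasis b))      ≡⟨ cong proj (extended-lincomb c b) ⟩
      proj ((c fzero · v) ⊕ lift0 rest)       ≡⟨ map-⊕ proj-linear _ _ ⟩
      proj (c fzero · v) ⊕ proj (lift0 rest)  ≡⟨ cong₂ _⊕_ (map-· proj-linear (c fzero) v) (proj-lift0 rest) ⟩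
      (c fzero · proj v) ⊕ rest               ≡⟨ cong (λ t → (c fzero · t) ⊕ rest) proj-v ⟩
      (c fzero · zeroV) ⊕ rest                ≡⟨ cong (_⊕ rest) (·-zeroʳ (c fzero)) ⟩
      zeroV ⊕ rest                            ≡⟨ ⊕-identityˡ rest ⟩
      rest                                    ∎
      where
      open ≡-Reasoning
      rest : Vecs n
      rest = lincomb (λ i → c (fsuc i)) b

    lam-extended : ∀ {k} (c : Fin (suc k) → Carrier) (b : Fin k → Vecs n) →
      lam (lincomb c (extendedBasis b)) ≡ c fzero
    lam-extended c b = begin
      lam (lincomb c (extendedBasis b))        ≡⟨ cong lam (extended-lincomb c b) ⟩
      lam ((c fzero · v) ⊕ lift0 rest)         ≡⟨ lam-⊕ _ _ ⟩
      lam (c fzero · v) + lam (lift0 rest)     ≡⟨ cong₂ _+_ (lam-· (c fzero) v) (lam-lift0 rest) ⟩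
      c fzero * lam v + 0#                     ≡⟨ +-identityʳ _ ⟩
      c fzero * lam v                          ≡⟨ cong (c fzero *_) β*β⁻ ⟩
      c fzero * 1#                             ≡⟨ *-identityʳ (c fzero) ⟩
      c fzero                                  ∎
      where
      open ≡-Reasoning
      rest : Vecs n
      rest = lincomb (λ i → c (fsuc i)) b

    extend-basis : ∀ {k} {X : VSet n} {Y : VSet (suc n)} {b : Fin k → Vecs n} →
      IsBasis X b → Y ≐ (λ w → X (proj w)) → IsBasis Y (extendedBasis b)
    extend-basis {k} {X} {Y} {b} (independent , spanning , inX) Y≐ =
      independent′ , spanning′ , λ c → proj₂ (Y≐ _) (subst X (sym (proj-extended c b)) (inX _))
      where
      independent′ : (c : Fin (suc k) → Carrier) → lincomb c (extendedBasis b) ≡ zeroV →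
        (i : Fin (suc k)) → c i ≡ 0#
      independent′ c c·b≡0 fzero =
        trans (sym (lam-extended c b)) (trans (cong lam c·b≡0) lam-zero)
      independent′ c c·b≡0 (fsuc i) = independent _
        (trans (sym (proj-extended c b)) (trans (cong proj c·b≡0) (map-0 proj-linear))) i

      spanning′ : (w : Vecs (suc n)) → Y w → ∃[ c ] (w ≡ lincomb c (extendedBasis b))
      spanning′ w Yw with spanning (proj w) (proj₁ (Y≐ w) Yw)
      ... | c′ , proj-w≡ = coefficients , (begin
        w                                           ≡⟨ decompose w ⟩
        lift0 (proj w) ⊕ (lam w · v)                ≡⟨ ⊕-comm _ _ ⟩
        (lam w · v) ⊕ lift0 (proj w)                ≡⟨ cong (λ t → (lam w · v) ⊕ lift0 t) proj-w≡ ⟩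
        (lam w · v) ⊕ lift0 (lincomb c′ b)          ≡⟨ sym (extended-lincomb coefficients b) ⟩
        lincomb coefficients (extendedBasis b)      ∎)
        where
        open ≡-Reasoning
        coefficients : Fin (suc k) → Carrier
        coefficients fzero    = lam w
        coefficients (fsuc i) = c′ i

    over-dim : ∀ {k} {X : VSet n} {Y : VSet (suc n)} →
      HasDim X k → Y ≐ (λ w → X (proj w)) → HasDim Y (suc k)
    over-dim (subX , b , basis) Y≐ =
      subspace-resp-≐ Y≐ (preimage-subspace proj-linear subX) , extendedBasis b , extend-basis basis Y≐

    extension-trivial : ∀ {m k} (C : Code m n) → ConstDim C k →
      TrivialCDC C k → TrivialCDC (extendCode C v) (suc k)
    extension-trivial C dims (inj₁ pointTrivial) =
      inj₁ (pointTrivial-pullback proj (extendCode C v) C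
              (λ i → extension-spec (proj₁ (dims i))) pointTrivial)
    extension-trivial {zero}  C dims (inj₂ _)       = inj₁ (λ _ → inj₁ (λ ()))
    extension-trivial {suc m} C dims (inj₂ spanDim) =
      inj₂ (over-dim spanDim (union-spec C (λ i → proj₁ (dims i))))

theorem9 :
    ((m n w d : ℕ) (C : BinCode m n) → DistinctRows C → ConstantWeight C w →
      EquidistantBin C d → TrivialBin C → TrivialBin (extendBin C))
    ×
    ((q : ℕ) (F : Field) → HasSize F q → (m n k : ℕ) →
      (C : LinAlg.Code F m n) → LinAlg.DistinctCode F C →
      LinAlg.ConstDim F C k → LinAlg.Equidistant F C →
      (v : LinAlg.Vecs F (suc n)) →
      ¬ (∃[ x ] (v ≡ LinAlg.pair F x (Field.0# F))) →
      LinAlg.TrivialCDC F C k → LinAlg.TrivialCDC F (LinAlg.extendCode F C v) (suc k))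
theorem9 =
    (λ m n w d C _ _ _ trivial → extendBin-trivial C trivial)
  , (λ q F _ m n k C _ dims _ v v∉ trivial →
       Extension.Along.extension-trivial F v v∉ C dims trivial)
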